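{- Let $A\subseteq\omega$ be any set and $S\subseteq\omega$ a computable set. Let $E_S=\{\langle x,0\rangle : x\in\omega\}\cup\{\langle x,1\rangle: x\in S\}$, let $\tau_S:\omega\to E_S$ be a computable bijection, and let $C_S=\{n\in\omega:\pi_1(\tau_S(n))\in A\}$. Then $C_S\equiv_{bfin}A$.
   Context: $\langle\cdot,\cdot\rangle$ is a standard computable pairing function on $\omega$ with computable projections $\pi_1,\pi_2$. $X\le_{bfin}Y$ means there is a total computable $f$ with $x\in X\iff f(x)\in Y$ for all $x$ and a constant $c\ge1$ with $|f^{ -1}(y)|\le c$ for all $y$; $\equiv_{bfin}$ is mutual $\le_{bfin}$-reducibility. -}

module Defs where

open import Data.Nat using (ℕ; zero; suc; _+_; _≤_; _<_)
open import Data.Fin using (Fin)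
open import Data.Vec using (Vec; []; _∷_; lookup)
open import Data.Product using (Σ; ∃; _×_; _,_; proj₁; proj₂)
open import Data.Sum using (_⊎_)
open import Data.List using (List; length)
open import Data.List.Relation.Unary.All using (All)
open import Data.List.Relation.Unary.Unique.Propositional using (Unique)
open import Relation.Binary.PropositionalEquality using (_≡_)
open import Relation.Nullary using (¬_)
open import Function.Bundles using (_⇔_)

data PR : ℕ → Set where
  zer  : ∀ {n} → PR n
  succ : PR 1
  proj : ∀ {n} → Fin n → PR n
  comp : ∀ {m n} → PR m → Vec (PR n) m → PR n
  prec : ∀ {n} → PR n → PR (suc (suc n)) → PR (suc n)
  mu   : ∀ {n} → PR (suc n) → PR n

mutual
  data Eval : ∀ {n} → PR n → Vec ℕ n → ℕ → Set where
    ev-zer  : ∀ {n} {v : Vec ℕ n} → Eval zer v 0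
    ev-succ : ∀ {x} → Eval succ (x ∷ []) (suc x)
    ev-proj : ∀ {n} {i : Fin n} {v : Vec ℕ n} → Eval (proj i) v (lookup v i)
    ev-comp : ∀ {m n} {f : PR m} {gs : Vec (PR n) m} {v : Vec ℕ n} {ws : Vec ℕ m} {a} →
              EvalVec gs v ws → Eval f ws a → Eval (comp f gs) v a
    ev-prec0 : ∀ {n} {g : PR n} {h : PR (suc (suc n))} {v : Vec ℕ n} {a} →
               Eval g v a → Eval (prec g h) (0 ∷ v) a
    ev-precS : ∀ {n} {g : PR n} {h : PR (suc (suc n))} {v : Vec ℕ n} {k b a} →
               Eval (prec g h) (k ∷ v) b → Eval h (k ∷ b ∷ v) a →
               Eval (prec g h) (suc k ∷ v) a
    ev-mu   : ∀ {n} {f : PR (suc n)} {v : Vec ℕ n} {m} →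
              Eval f (m ∷ v) 0 →
              (∀ k → k < m → Σ ℕ λ b → Eval f (k ∷ v) (suc b)) →
              Eval (mu f) v m

  data EvalVec : ∀ {m n} → Vec (PR n) m → Vec ℕ n → Vec ℕ m → Set where
    evv-[] : ∀ {n} {v : Vec ℕ n} → EvalVec [] v []
    evv-∷  : ∀ {m n} {g : PR n} {gs : Vec (PR n) m} {v : Vec ℕ n} {a} {ws : Vec ℕ m} →
             Eval g v a → EvalVec gs v ws → EvalVec (g ∷ gs) v (a ∷ ws)

Computable : (ℕ → ℕ) → Set
Computable f = Σ (PR 1) λ e → ∀ x → Eval e (x ∷ []) (f x)

ComputableSet : (ℕ → Set) → Set
ComputableSet S = Σ (ℕ → ℕ) λ χ → Computable χ × (∀ x → S x ⇔ (χ x ≡ 1))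

tri : ℕ → ℕ
tri zero    = 0
tri (suc k) = suc k + tri k

⟨_,_⟩ : ℕ → ℕ → ℕ
⟨ x , y ⟩ = tri (x + y) + y

unpair : ℕ → ℕ × ℕ
unpair zero = 0 , 0
unpair (suc n) with unpair n
... | zero  , y = suc y , 0
... | suc x , y = x , suc y

π₁ π₂ : ℕ → ℕ
π₁ n = proj₁ (unpair n)
π₂ n = proj₂ (unpair n)

-- |f⁻¹(y)| ≤ c for all y: every duplicate-free list of preimages of y has length ≤ c.
PreimagesBoundedBy : (ℕ → ℕ) → ℕ → Set
PreimagesBoundedBy f c = ∀ y (l : List ℕ) → Unique l → All (λ x → f x ≡ y) l → length l ≤ c

_≤bfin_ : (ℕ → Set) → (ℕ → Set) → Set
X ≤bfin Y = Σ (ℕ → ℕ) λ f → Computable f × (∀ x → X x ⇔ Y (f x)) ×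
            (Σ ℕ λ c → 1 ≤ c × PreimagesBoundedBy f c)

_≡bfin_ : (ℕ → Set) → (ℕ → Set) → Set
X ≡bfin Y = (X ≤bfin Y) × (Y ≤bfin X)

E : (ℕ → Set) → ℕ → Set
E S y = (Σ ℕ λ x → y ≡ ⟨ x , 0 ⟩) ⊎ (Σ ℕ λ x → S x × y ≡ ⟨ x , 1 ⟩)

-- τ is a bijection from ω onto E_S (viewed as a function ℕ → ℕ with range E_S).
IsBijectionOnto : (ℕ → ℕ) → (ℕ → Set) → Set
IsBijectionOnto τ P = (∀ n → P (τ n)) × (∀ m n → τ m ≡ τ n → m ≡ n) ×
                      (∀ y → P y → Σ ℕ λ n → τ n ≡ y)

C : (ℕ → Set) → (ℕ → ℕ) → ℕ → Set
C A τ n = A (π₁ (τ n))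

-- A C_S-instance n is reduced to A by n ↦ π₁ (τ n); every point of E_S with first
-- coordinate y is ⟨ y , 0 ⟩ or ⟨ y , 1 ⟩, so by injectivity of τ each fibre has at most
-- two elements. Conversely x ↦ τ⁻¹ ⟨ x , 0 ⟩ reduces A to C_S: it is found by unbounded
-- search because τ is computable, and it is injective because π₁ recovers x. Both maps
-- need π₁ to be computable: π₁ n = s ∸ (n ∸ tri s) for the least s with n < tri (s + 1).
module Submission where

open import Defs
open import Data.Nat using (ℕ; zero; suc; _+_; _∸_; _≤_; _<_; z≤n; s≤s; pred)
open import Data.Nat.Properties
open import Data.Fin using (#_)
open import Data.Vec using (Vec; []; _∷_)
open import Data.Product using (Σ; _,_; proj₁; proj₂)
open import Data.Sum using (inj₁; inj₂)
open import Data.List using (List; []; _∷_; _++_; length; map)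
open import Data.List.Properties using (length-map; length-++-sucʳ)
open import Data.List.Membership.Propositional using (_∈_)
open import Data.List.Membership.Propositional.Properties using (∈-∃++; ∈-++⁻; ∈-++⁺ˡ; ∈-++⁺ʳ; ∈-map⁻)
open import Data.List.Relation.Binary.Subset.Propositional using (_⊆_)
import Data.List.Relation.Unary.All as All
open import Data.List.Relation.Unary.Any using (here; there)
open import Data.List.Relation.Unary.AllPairs using (_∷_)
open import Data.List.Relation.Unary.Unique.Propositional using (Unique)
import Data.List.Relation.Unary.Unique.Propositional.Properties as Unique
open import Data.Empty using (⊥-elim)
open import Function.Base using (_∘_; id)
open import Function.Bundles using (mk⇔)
open import Relation.Binary.PropositionalEquality

ev-comp₁ : ∀ {n} {f : PR 1} {g : PR n} {v : Vec ℕ n} {a b} →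
           Eval g v a → Eval f (a ∷ []) b → Eval (comp f (g ∷ [])) v b
ev-comp₁ g-a f-b = ev-comp (evv-∷ g-a evv-[]) f-b

ev-comp₂ : ∀ {n} {f : PR 2} {g h : PR n} {v : Vec ℕ n} {a b c} →
           Eval g v a → Eval h v b → Eval f (a ∷ b ∷ []) c →
           Eval (comp f (g ∷ h ∷ [])) v c
ev-comp₂ g-a h-b f-c = ev-comp (evv-∷ g-a (evv-∷ h-b evv-[])) f-c

ev-mu-least : ∀ {n} {e : PR (suc n)} {v : Vec ℕ n} (h : ℕ → ℕ) →
              (∀ k → Eval e (k ∷ v) (h k)) →
              ∀ {m} → h m ≡ 0 → (∀ k → k < m → h k ≢ 0) → Eval (mu e) v m
ev-mu-least {e = e} {v} h e-h {m} hm≡0 h≢0 = ev-mu (subst (Eval e (m ∷ v)) hm≡0 (e-h m)) positive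
  where
  positive : ∀ k → k < m → Σ ℕ λ b → Eval e (k ∷ v) (suc b)
  positive k k<m with h k | e-h k | h≢0 k k<m
  ... | zero  | _   | hk≢0 = ⊥-elim (hk≢0 refl)
  ... | suc b | e-k | _    = b , e-k

Computable-∘ : ∀ {f g} → Computable f → Computable g → Computable (f ∘ g)
Computable-∘ {f} {g} (e , e-f) (d , d-g) = comp e (d ∷ []) , λ x → ev-comp₁ (d-g x) (e-f (g x))

addP : PR 2
addP = prec (proj (# 0)) (comp succ (proj (# 1) ∷ []))

addP-correct : ∀ a b → Eval addP (a ∷ b ∷ []) (a + b)
addP-correct zero    b = ev-prec0 ev-proj
addP-correct (suc a) b = ev-precS (addP-correct a b) (ev-comp₁ ev-proj ev-succ)

predP : PR 1
predP = prec zer (proj (# 0))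

predP-correct : ∀ a → Eval predP (a ∷ []) (pred a)
predP-correct zero    = ev-prec0 ev-zer
predP-correct (suc a) = ev-precS (predP-correct a) ev-proj

flippedMonusP : PR 2
flippedMonusP = prec (proj (# 0)) (comp predP (proj (# 1) ∷ []))

flippedMonusP-correct : ∀ k a → Eval flippedMonusP (k ∷ a ∷ []) (a ∸ k)
flippedMonusP-correct zero    a = ev-prec0 ev-proj
flippedMonusP-correct (suc k) a = subst (Eval flippedMonusP (suc k ∷ a ∷ [])) (pred[m∸n]≡m∸[1+n] a k)
  (ev-precS (flippedMonusP-correct k a) (ev-comp₁ ev-proj (predP-correct (a ∸ k))))

monusP : PR 2
monusP = comp flippedMonusP (proj (# 1) ∷ proj (# 0) ∷ [])

monusP-correct : ∀ a b → Eval monusP (a ∷ b ∷ []) (a ∸ b)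
monusP-correct a b = ev-comp₂ ev-proj ev-proj (flippedMonusP-correct b a)

triP : PR 1
triP = prec zer (comp addP (comp succ (proj (# 0) ∷ []) ∷ proj (# 1) ∷ []))

triP-correct : ∀ k → Eval triP (k ∷ []) (tri k)
triP-correct zero    = ev-prec0 ev-zer
triP-correct (suc k) = ev-precS (triP-correct k)
  (ev-comp₂ (ev-comp₁ ev-proj ev-succ) ev-proj (addP-correct (suc k) (tri k)))

pairP : PR 2
pairP = comp addP (comp triP (addP ∷ []) ∷ proj (# 1) ∷ [])

pairP-correct : ∀ x y → Eval pairP (x ∷ y ∷ []) ⟨ x , y ⟩
pairP-correct x y = ev-comp₂ (ev-comp₁ (addP-correct x y) (triP-correct (x + y))) ev-proj
  (addP-correct (tri (x + y)) y)

distanceP : PR 2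
distanceP = comp addP (monusP ∷ comp monusP (proj (# 1) ∷ proj (# 0) ∷ []) ∷ [])

distanceP-correct : ∀ a b → Eval distanceP (a ∷ b ∷ []) ((a ∸ b) + (b ∸ a))
distanceP-correct a b = ev-comp₂ (monusP-correct a b) (ev-comp₂ ev-proj ev-proj (monusP-correct b a))
  (addP-correct (a ∸ b) (b ∸ a))

m≡n⇒m∸n+n∸m≡0 : ∀ {m n} → m ≡ n → (m ∸ n) + (n ∸ m) ≡ 0
m≡n⇒m∸n+n∸m≡0 {m} refl rewrite n∸n≡0 m = refl

m∸n+n∸m≡0⇒m≡n : ∀ {m n} → (m ∸ n) + (n ∸ m) ≡ 0 → m ≡ n
m∸n+n∸m≡0⇒m≡n {m} {n} eq =
  ≤-antisym (m∸n≡0⇒m≤n (m+n≡0⇒m≡0 (m ∸ n) eq)) (m∸n≡0⇒m≤n (m+n≡0⇒n≡0 (m ∸ n) eq))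

tri-mono-≤ : ∀ {m n} → m ≤ n → tri m ≤ tri n
tri-mono-≤ z≤n       = z≤n
tri-mono-≤ (s≤s m≤n) = +-mono-≤ (s≤s m≤n) (tri-mono-≤ m≤n)

suc-pair-shift : ∀ x y → suc ⟨ suc x , y ⟩ ≡ ⟨ x , suc y ⟩
suc-pair-shift x y rewrite +-suc x y = sym (+-suc (tri (suc (x + y))) y)

suc-pair-wrap : ∀ y → suc ⟨ 0 , y ⟩ ≡ ⟨ suc y , 0 ⟩
suc-pair-wrap y rewrite +-identityʳ y = cong suc (trans (+-comm (tri y) y) (sym (+-identityʳ (y + tri y))))

pair-unpair : ∀ n → ⟨ π₁ n , π₂ n ⟩ ≡ n
pair-unpair zero = refl
pair-unpair (suc n) with unpair n | pair-unpair n
... | zero  , y | ⟨0,y⟩≡n   = trans (sym (suc-pair-wrap y)) (cong suc ⟨0,y⟩≡n)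
... | suc x , y | ⟨1+x,y⟩≡n = trans (sym (suc-pair-shift x y)) (cong suc ⟨1+x,y⟩≡n)

unpair-suc-shift : ∀ {m x y} → unpair m ≡ (suc x , y) → unpair (suc m) ≡ (x , suc y)
unpair-suc-shift eq rewrite eq = refl

unpair-suc-wrap : ∀ {m y} → unpair m ≡ (0 , y) → unpair (suc m) ≡ (suc y , 0)
unpair-suc-wrap eq rewrite eq = refl

unpair-pair : ∀ x y → unpair ⟨ x , y ⟩ ≡ (x , y)
unpair-pair x y = along-diagonal (x + y) x y refl
  where
  along-diagonal : ∀ s x y → x + y ≡ s → unpair ⟨ x , y ⟩ ≡ (x , y)
  along-diagonal s       zero    zero    _  = refl
  along-diagonal s       x       (suc y) eq = subst (λ m → unpair m ≡ (x , suc y)) (suc-pair-shift x y)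
    (unpair-suc-shift {⟨ suc x , y ⟩} (along-diagonal s (suc x) y (trans (sym (+-suc x y)) eq)))
  along-diagonal (suc s) (suc x) zero    eq = subst (λ m → unpair m ≡ (suc x , 0)) (suc-pair-wrap x)
    (unpair-suc-wrap {⟨ 0 , x ⟩} (along-diagonal s 0 x
      (suc-injective (trans (sym (+-identityʳ (suc x))) eq))))

π₁-pair : ∀ x y → π₁ ⟨ x , y ⟩ ≡ x
π₁-pair x y = cong proj₁ (unpair-pair x y)

pair-lower-bound : ∀ x y → tri (x + y) ≤ ⟨ x , y ⟩
pair-lower-bound x y = m≤m+n (tri (x + y)) y

pair-upper-bound : ∀ x y → ⟨ x , y ⟩ < tri (suc (x + y))
pair-upper-bound x y = s≤s (begin
  tri (x + y) + y       ≤⟨ +-monoʳ-≤ (tri (x + y)) (m≤n+m y x) ⟩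
  tri (x + y) + (x + y) ≡⟨ +-comm (tri (x + y)) (x + y) ⟩
  (x + y) + tri (x + y) ∎)
  where open ≤-Reasoning

diagonalTestP : PR 2
diagonalTestP =
  comp monusP (comp succ (proj (# 1) ∷ []) ∷ comp triP (comp succ (proj (# 0) ∷ []) ∷ []) ∷ [])

diagonalTestP-correct : ∀ n s → Eval diagonalTestP (s ∷ n ∷ []) (suc n ∸ tri (suc s))
diagonalTestP-correct n s =
  ev-comp₂ (ev-comp₁ ev-proj ev-succ) (ev-comp₁ (ev-comp₁ ev-proj ev-succ) (triP-correct (suc s)))
    (monusP-correct (suc n) (tri (suc s)))

diagonalP : PR 1
diagonalP = mu diagonalTestP

diagonalP-correct : ∀ x y → Eval diagonalP (⟨ x , y ⟩ ∷ []) (x + y)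
diagonalP-correct x y = ev-mu-least _ (diagonalTestP-correct ⟨ x , y ⟩)
  (m≤n⇒m∸n≡0 (pair-upper-bound x y)) below-diagonal
  where
  below-diagonal : ∀ k → k < x + y → suc ⟨ x , y ⟩ ∸ tri (suc k) ≢ 0
  below-diagonal k k<x+y eq = <-irrefl refl (begin-strict
    ⟨ x , y ⟩     <⟨ m∸n≡0⇒m≤n eq ⟩
    tri (suc k)   ≤⟨ tri-mono-≤ k<x+y ⟩
    tri (x + y)   ≤⟨ pair-lower-bound x y ⟩
    ⟨ x , y ⟩     ∎)
    where open ≤-Reasoning

fstP : PR 1
fstP = comp monusP (diagonalP ∷ comp monusP (proj (# 0) ∷ comp triP (diagonalP ∷ []) ∷ []) ∷ [])

fstP-correct : ∀ x y → Eval fstP (⟨ x , y ⟩ ∷ []) x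
fstP-correct x y = subst (Eval fstP (⟨ x , y ⟩ ∷ [])) x+y∸y≡x
  (ev-comp₂ diagonal (ev-comp₂ ev-proj (ev-comp₁ diagonal (triP-correct (x + y))) (monusP-correct _ _))
    (monusP-correct (x + y) (⟨ x , y ⟩ ∸ tri (x + y))))
  where
  diagonal : Eval diagonalP (⟨ x , y ⟩ ∷ []) (x + y)
  diagonal = diagonalP-correct x y
  x+y∸y≡x : (x + y) ∸ (⟨ x , y ⟩ ∸ tri (x + y)) ≡ x
  x+y∸y≡x = trans (cong ((x + y) ∸_) (m+n∸m≡n (tri (x + y)) y)) (m+n∸n≡m x y)

π₁-computable : Computable π₁
π₁-computable = fstP , λ n →
  subst (λ m → Eval fstP (m ∷ []) (π₁ n)) (pair-unpair n) (fstP-correct (π₁ n) (π₂ n))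

unique-⊆⇒length-≤ : ∀ {a} {A : Set a} {xs ys : List A} → Unique xs → xs ⊆ ys → length xs ≤ length ys
unique-⊆⇒length-≤ {xs = []}     _                     _       = z≤n
unique-⊆⇒length-≤ {xs = x ∷ xs} (x∉xs ∷ unique-xs) x∷xs⊆ys with ∈-∃++ (x∷xs⊆ys (here refl))
... | as , bs , refl = begin
  suc (length xs)         ≤⟨ s≤s (unique-⊆⇒length-≤ unique-xs xs⊆as++bs) ⟩
  suc (length (as ++ bs)) ≡⟨ length-++-sucʳ as x bs ⟨
  length (as ++ x ∷ bs)   ∎
  where
  open ≤-Reasoning
  xs⊆as++bs : xs ⊆ as ++ bs
  xs⊆as++bs {z} z∈xs with ∈-++⁻ as (x∷xs⊆ys (there z∈xs))
  ... | inj₁ z∈as         = ∈-++⁺ˡ z∈as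
  ... | inj₂ (here z≡x)   = ⊥-elim (All.lookup x∉xs z∈xs (sym z≡x))
  ... | inj₂ (there z∈bs) = ∈-++⁺ʳ as z∈bs

injection-into-targets⇒PreimagesBoundedBy : ∀ {f c} (h : ℕ → ℕ) (targets : ℕ → List ℕ) →
  (∀ {a b} → h a ≡ h b → a ≡ b) → (∀ x → h x ∈ targets (f x)) → (∀ y → length (targets y) ≤ c) →
  PreimagesBoundedBy f c
injection-into-targets⇒PreimagesBoundedBy {c = c} h targets h-injective h∈targets few-targets
  y l unique-l l⊆fibre = begin
    length l           ≡⟨ length-map h l ⟨
    length (map h l)   ≤⟨ unique-⊆⇒length-≤ (Unique.map⁺ h-injective unique-l) image⊆targets ⟩
    length (targets y) ≤⟨ few-targets y ⟩
    c                  ∎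
  where
  open ≤-Reasoning
  image⊆targets : map h l ⊆ targets y
  image⊆targets w∈image with ∈-map⁻ h w∈image
  ... | x , x∈l , refl = subst (λ z → h x ∈ targets z) (All.lookup l⊆fibre x∈l) (h∈targets x)

injective⇒PreimagesBoundedBy-1 : ∀ {f} → (∀ {a b} → f a ≡ f b → a ≡ b) → PreimagesBoundedBy f 1
injective⇒PreimagesBoundedBy-1 {f} f-injective =
  injection-into-targets⇒PreimagesBoundedBy f (_∷ []) f-injective (λ _ → here refl) (λ _ → ≤-refl)

module _ {S : ℕ → Set} {τ : ℕ → ℕ} (τ-bijection : IsBijectionOnto τ (E S)) where

  private
    τ-injective : ∀ {m n} → τ m ≡ τ n → m ≡ n
    τ-injective = proj₁ (proj₂ τ-bijection) _ _

  E-cover : ∀ {w} → E S w → w ∈ ⟨ π₁ w , 0 ⟩ ∷ ⟨ π₁ w , 1 ⟩ ∷ []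
  E-cover (inj₁ (x , refl))     = here (cong ⟨_, 0 ⟩ (sym (π₁-pair x 0)))
  E-cover (inj₂ (x , _ , refl)) = there (here (cong ⟨_, 1 ⟩ (sym (π₁-pair x 1))))

  π₁∘τ-PreimagesBoundedBy-2 : PreimagesBoundedBy (π₁ ∘ τ) 2
  π₁∘τ-PreimagesBoundedBy-2 = injection-into-targets⇒PreimagesBoundedBy τ (λ y → ⟨ y , 0 ⟩ ∷ ⟨ y , 1 ⟩ ∷ [])
    τ-injective (λ n → E-cover (proj₁ τ-bijection n)) (λ _ → ≤-refl)

  index : ℕ → ℕ
  index x = proj₁ (proj₂ (proj₂ τ-bijection) ⟨ x , 0 ⟩ (inj₁ (x , refl)))

  τ-index : ∀ x → τ (index x) ≡ ⟨ x , 0 ⟩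
  τ-index x = proj₂ (proj₂ (proj₂ τ-bijection) ⟨ x , 0 ⟩ (inj₁ (x , refl)))

  π₁-τ-index : ∀ x → π₁ (τ (index x)) ≡ x
  π₁-τ-index x = trans (cong π₁ (τ-index x)) (π₁-pair x 0)

  index-injective : ∀ {x y} → index x ≡ index y → x ≡ y
  index-injective {x} {y} eq = trans (sym (π₁-τ-index x)) (trans (cong (π₁ ∘ τ) eq) (π₁-τ-index y))

  -- index x is the unique, hence least, m with τ m = ⟨ x , 0 ⟩, so it is found by minimisation.
  index-computable : Computable τ → Computable index
  index-computable (e , e-τ) = mu testP , λ x → ev-mu-least (distance x) (testP-correct x)
    (m≡n⇒m∸n+n∸m≡0 (τ-index x)) (below-index x)
    where
    testP : PR 2
    testP = comp distanceP (comp e (proj (# 0) ∷ []) ∷ comp pairP (proj (# 1) ∷ zer ∷ []) ∷ [])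
    distance : ℕ → ℕ → ℕ
    distance x m = (τ m ∸ ⟨ x , 0 ⟩) + (⟨ x , 0 ⟩ ∸ τ m)
    testP-correct : ∀ x m → Eval testP (m ∷ x ∷ []) (distance x m)
    testP-correct x m = ev-comp₂ (ev-comp₁ ev-proj (e-τ m)) (ev-comp₂ ev-proj ev-zer (pairP-correct x 0))
      (distanceP-correct (τ m) ⟨ x , 0 ⟩)
    below-index : ∀ x k → k < index x → distance x k ≢ 0
    below-index x k k<index eq =
      <-irrefl (τ-injective (trans (m∸n+n∸m≡0⇒m≡n eq) (sym (τ-index x)))) k<index

  C≤bfinA : (A : ℕ → Set) → Computable τ → C A τ ≤bfin A
  C≤bfinA A τ-computable = π₁ ∘ τ , Computable-∘ π₁-computable τ-computable , (λ _ → mk⇔ id id) ,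
    2 , s≤s z≤n , π₁∘τ-PreimagesBoundedBy-2

  A≤bfinC : (A : ℕ → Set) → Computable τ → A ≤bfin C A τ
  A≤bfinC A τ-computable = index , index-computable τ-computable ,
    (λ x → mk⇔ (subst A (sym (π₁-τ-index x))) (subst A (π₁-τ-index x))) ,
    1 , s≤s z≤n , injective⇒PreimagesBoundedBy-1 index-injective

lemma6p3 : (A S : ℕ → Set) → ComputableSet S →
    (τ : ℕ → ℕ) → Computable τ → IsBijectionOnto τ (E S) →
    C A τ ≡bfin A
lemma6p3 A S _ τ τ-computable τ-bijection =
  C≤bfinA τ-bijection A τ-computable , A≤bfinC τ-bijection A τ-computable
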